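{- Let $q$ be a prime power, let $K_1$ and $K_2$ be two $k$-dimensional subspaces of a finite-dimensional $F_q$-vector space, let $s=\dim(K_1\cap K_2)$, and let $t$ be an integer with $0\le t\le k$. Then for every integer $i$ with $0\le i\le s$, the number of pairs $(T_1,T_2)$ consisting of a $t$-dimensional subspace $T_1$ of $K_1$ and a $t$-dimensional subspace $T_2$ of $K_2$ with $\dim(T_1\cap T_2)=i$ is at most $$\begin{bmatrix} s\\ i\end{bmatrix}_q\begin{bmatrix} k-i\\ t-i\end{bmatrix}_q^2.$$
   Context: For integers $n\ge k\ge 0$, $\begin{bmatrix} n\\ k\end{bmatrix}_q=\prod_{i=1}^{k}\frac{q^{n-k+i}-1}{q^i-1}$ is the number of $k$-dimensional subspaces of an $n$-dimensional $F_q$-space; by convention it is $0$ if $k<0$. -}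

module Defs where

open import Level using (0ℓ)
open import Data.Nat using (ℕ; zero; suc)
import Data.Nat as ℕ
open import Data.Integer using (ℤ; +_; -[1+_])
open import Data.Fin using (Fin)
import Data.Fin as Fin
open import Data.Product using (Σ; _×_; _,_)
open import Relation.Nullary using (¬_)
open import Algebra.Bundles using (CommutativeRing)
open import Function.Bundles using (Inverse)
import Relation.Binary.PropositionalEquality as ≡

-- Gaussian binomial coefficients [n k]_q (natural numbers),
-- defined by the q-Pascal recursion
--   [0,0]=1, [0,k+1]=0, [n+1,0]=1, [n+1,k+1] = [n,k] + q^(k+1) [n,k+1],
-- which agrees with prod_{i=1}^k (q^{n-k+i}-1)/(q^i-1) for n ≥ k and
-- gives 0 when k > n.

qbinom : ℕ → ℕ → ℕ → ℕ
qbinom q zero    zero    = 1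
qbinom q zero    (suc k) = 0
qbinom q (suc n) zero    = 1
qbinom q (suc n) (suc k) = qbinom q n k ℕ.+ q ℕ.^ suc k ℕ.* qbinom q n (suc k)

-- integer lower index: 0 when k < 0 (the stated convention)
qbinomℤ : ℕ → ℕ → ℤ → ℕ
qbinomℤ q n (+ k)      = qbinom q n k
qbinomℤ q n -[1+ k ]   = 0

record FiniteField (q : ℕ) : Set₁ where
  field
    commRing : CommutativeRing 0ℓ 0ℓ
  open CommutativeRing commRing public
  field
    0≉1     : ¬ (0# ≈ 1#)
    inverse : ∀ x → ¬ (x ≈ 0#) → Σ Carrier (λ y → (x * y) ≈ 1#)
    card    : Inverse (≡.setoid (Fin q)) setoid

module LinAlg {q : ℕ} (F : FiniteField q) (n : ℕ) where
  open FiniteField F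

  V : Set
  V = Fin n → Carrier

  _≈ᵥ_ : V → V → Set
  u ≈ᵥ v = ∀ j → u j ≈ v j

  0ᵥ : V
  0ᵥ _ = 0#

  _+ᵥ_ : V → V → V
  (u +ᵥ v) j = u j + v j

  _·_ : Carrier → V → V
  (a · v) j = a * v j

  comb : {d : ℕ} → (Fin d → Carrier) → (Fin d → V) → V
  comb {zero}  c b = 0ᵥ
  comb {suc d} c b = (c Fin.zero · b Fin.zero) +ᵥ comb (λ j → c (Fin.suc j)) (λ j → b (Fin.suc j))

  record Subspace : Set₁ where
    field
      mem  : V → Set
      resp : ∀ {u v} → u ≈ᵥ v → mem u → mem v
      0∈   : mem 0ᵥ
      +∈   : ∀ {u v} → mem u → mem v → mem (u +ᵥ v)
      ·∈   : ∀ a {v} → mem v → mem (a · v)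
  open Subspace public

  _∩_ : Subspace → Subspace → Subspace
  W ∩ U = record
    { mem  = λ v → mem W v × mem U v
    ; resp = λ { e (x , y) → resp W e x , resp U e y }
    ; 0∈   = 0∈ W , 0∈ U
    ; +∈   = λ { (x , y) (x' , y') → +∈ W x x' , +∈ U y y' }
    ; ·∈   = λ { a (x , y) → ·∈ W a x , ·∈ U a y }
    }

  _⊆_ : Subspace → Subspace → Set
  W ⊆ U = ∀ v → mem W v → mem U v

  _≐_ : Subspace → Subspace → Set
  W ≐ U = (W ⊆ U) × (U ⊆ W)

  LinIndep : {d : ℕ} → (Fin d → V) → Set
  LinIndep b = ∀ c → comb c b ≈ᵥ 0ᵥ → ∀ j → c j ≈ 0#

  HasDim : Subspace → ℕ → Set
  HasDim W d = Σ (Fin d → V) λ b →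
      (∀ j → mem W (b j)) × LinIndep b ×
      (∀ w → mem W w → Σ (Fin d → Carrier) λ c → w ≈ᵥ comb c b)

  DistinctPairs : Subspace × Subspace → Subspace × Subspace → Set
  DistinctPairs (T₁ , T₂) (T₁' , T₂') = ¬ ((T₁ ≐ T₁') × (T₂ ≐ T₂'))

{-# OPTIONS --safe #-}

-- Distinct pairs (T₁, T₂) are counted through codes: a subspace is coded by the list of vectors of
-- F_q^n it contains, and a pair by the codes of T₁ ∩ T₂, T₁ and T₂. Grouping the codes first by the
-- i-dimensional intersection I ⊆ K₁ ∩ K₂ and then by T₁ reduces the bound to counting d-dimensional
-- subspaces T with U ⊆ T ⊆ W, where dim U = a and dim W = m: there are at most [m − a, d − a]_q of
-- them. This is a double count of the independent tuples (x₁, …, x_r), r = d − a, extending a basis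
-- of U: each T contains at least ∏_{j<r} (q^d − q^(a+j)) of them, a tuple determines the T it spans,
-- and W contains at most ∏_{j<r} (q^m − q^(a+j)); the quotient of the two products is the Gaussian
-- binomial.

module Submission where

open import Defs
open import Data.Nat using (ℕ; _<_)

module Counting where

  open import Data.Bool using (true; false)
  open import Data.List using (List; []; _∷_; [_]; length; map; filter; _++_)
  open import Data.List.Properties using (length-++; length-map; length-removeAt′)
  open import Data.List.Membership.Propositional using (_∈_)
  open import Data.List.Relation.Binary.Disjoint.Propositional using (Disjoint)
  open import Data.List.Relation.Unary.All as All using (All; []; _∷_)
  import Data.List.Relation.Unary.All.Properties as All
  open import Data.List.Relation.Unary.AllPairs using (AllPairs; []; _∷_)
  open import Data.List.Relation.Unary.Any using (here; there; index; _─_)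
  open import Data.List.Relation.Unary.Unique.Propositional using (Unique)
  import Data.List.Relation.Unary.Unique.Propositional.Properties as Unique
  open import Data.Nat using (ℕ; zero; suc; _+_; _*_; _≤_; z≤n; s≤s)
  open import Data.Nat.Properties using (≤-trans; ≤-pred; +-mono-≤; +-suc; module ≤-Reasoning)
  open import Data.Product using (Σ; _×_; _,_; proj₁)
  open import Function using (_∘_)
  open import Relation.Binary.Definitions using (DecidableEquality)
  open import Relation.Binary.PropositionalEquality using (_≡_; _≢_; refl; sym; trans; cong; subst)
  open import Relation.Nullary using (contradiction; does)
  open import Relation.Unary using (Decidable)
  open import Relation.Unary.Properties using (∁?)

  Bounded : {A : Set} → (A → Set) → ℕ → Set
  Bounded {A} P N = (xs : List A) → Unique xs → All P xs → length xs ≤ N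

  AtLeast : {A : Set} → ℕ → (A → Set) → Set
  AtLeast {A} N P = Σ (List A) λ xs → Unique xs × N ≤ length xs × All P xs

  module _ {A : Set} where

    ∈-─ : ∀ {x z : A} {ys} (x∈ys : x ∈ ys) → z ∈ ys → z ≢ x → z ∈ (ys ─ x∈ys)
    ∈-─ (here refl) (here refl) z≢x   = contradiction refl z≢x
    ∈-─ (here refl) (there z∈ys) _    = z∈ys
    ∈-─ (there _)   (here refl) _     = here refl
    ∈-─ (there x∈ys) (there z∈ys) z≢x = there (∈-─ x∈ys z∈ys z≢x)

    Unique-⊆⇒length≤ : ∀ {xs ys : List A} → Unique xs → All (_∈ ys) xs → length xs ≤ length ys
    Unique-⊆⇒length≤ [] [] = z≤n
    Unique-⊆⇒length≤ {x ∷ xs} {ys} (x∉xs ∷ uniq) (x∈ys ∷ xs⊆ys) = begin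
      suc (length xs)          ≤⟨ s≤s (Unique-⊆⇒length≤ uniq (All.zipWith remaining (x∉xs , xs⊆ys))) ⟩
      suc (length (ys ─ x∈ys)) ≡⟨ length-removeAt′ ys (index x∈ys) ⟨
      length ys                ∎
      where
      open ≤-Reasoning
      remaining : ∀ {z} → x ≢ z × z ∈ ys → z ∈ (ys ─ x∈ys)
      remaining (x≢z , z∈ys) = ∈-─ x∈ys z∈ys (x≢z ∘ sym)

    length-filter+length-filter-∁ : ∀ {P : A → Set} (P? : Decidable P) xs →
      length (filter P? xs) + length (filter (∁? P?) xs) ≡ length xs
    length-filter+length-filter-∁ P? [] = refl
    length-filter+length-filter-∁ P? (x ∷ xs) with does (P? x)
    ... | true  = cong suc (length-filter+length-filter-∁ P? xs)
    ... | false = trans (+-suc _ _) (cong suc (length-filter+length-filter-∁ P? xs))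

    All-filter : ∀ {P Q : A → Set} (P? : Decidable P) {xs} → All Q xs → All (λ x → Q x × P x) (filter P? xs)
    All-filter P? {xs} qs = All.zip (All.filter⁺ P? qs , All.all-filter P? xs)

    Bounded-enumeration : ∀ {P : A → Set} ys → (∀ {x} → P x → x ∈ ys) → Bounded P (length ys)
    Bounded-enumeration ys complete xs uniq pxs = Unique-⊆⇒length≤ uniq (All.map complete pxs)

    Bounded-mono : ∀ {P Q : A → Set} {N} → (∀ {x} → Q x → P x) → Bounded P N → Bounded Q N
    Bounded-mono Q⊆P bound xs uniq qxs = bound xs uniq (All.map Q⊆P qxs)

    Bounded-++ : ∀ {P : A → Set} {N xs ys} → Bounded P N → Unique xs → Unique ys → Disjoint xs ys →
                 All P xs → All P ys → length xs + length ys ≤ N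
    Bounded-++ {N = N} {xs} {ys} bound uxs uys disjoint pxs pys =
      subst (_≤ N) (length-++ xs) (bound (xs ++ ys) (Unique.++⁺ uxs uys disjoint) (All.++⁺ pxs pys))

    Bounded-without : ∀ {P : A → Set} {N a} → Bounded P (suc N) → P a → Bounded (λ x → P x × x ≢ a) N
    Bounded-without bound pa xs uniq pxs =
      ≤-pred (bound (_ ∷ xs) (All.map (λ (_ , x≢a) → x≢a ∘ sym) pxs ∷ uniq) (pa ∷ All.map proj₁ pxs))

  module _ {A B : Set} {P : A → Set} {Q : B → Set} where

    preimages : (f : A → B) → (∀ {y} → Q y → Σ A λ x → P x × f x ≡ y) →
                ∀ {ys} → All Q ys → Σ (List A) λ xs → All P xs × map f xs ≡ ys
    preimages f cover [] = [] , [] , refl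
    preimages f cover (qy ∷ qys) with cover qy | preimages f cover qys
    ... | x , px , refl | xs , pxs , refl = x ∷ xs , px ∷ pxs , refl

    Bounded-image : ∀ {N} (f : A → B) → (∀ {y} → Q y → Σ A λ x → P x × f x ≡ y) → Bounded P N → Bounded Q N
    Bounded-image {N} f cover bound ys uniq qys with preimages f cover qys
    ... | xs , pxs , refl = subst (_≤ N) (sym (length-map f xs)) (bound xs (Unique.map⁻ uniq) pxs)

    fibres-concat : ∀ {c} (tag : B → A) → (∀ {x} → P x → AtLeast c (λ y → Q y × tag y ≡ x)) →
                    ∀ xs → Unique xs → All P xs → AtLeast (length xs * c) (λ z → Q z × tag z ∈ xs)
    fibres-concat tag fibre [] [] [] = [] , [] , z≤n , []
    fibres-concat {c} tag fibre (x ∷ xs) (x∉xs ∷ uniq) (px ∷ pxs)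
      with fibre px | fibres-concat tag fibre xs uniq pxs
    ... | ys , uys , c≤ys , qys | zs , uzs , c*xs≤zs , qzs =
      ys ++ zs ,
      Unique.++⁺ uys uzs disjoint ,
      subst (c + length xs * c ≤_) (sym (length-++ ys)) (+-mono-≤ c≤ys c*xs≤zs) ,
      All.++⁺ (All.map (λ (qy , tagy≡x) → qy , here tagy≡x) qys)
              (All.map (λ (qz , tagz∈xs) → qz , there tagz∈xs) qzs)
      where
      disjoint : Disjoint ys zs
      disjoint (y∈ys , y∈zs) with All.lookup qys y∈ys | All.lookup qzs y∈zs
      ... | _ , refl | _ , x∈xs = All.All¬⇒¬Any x∉xs x∈xs

    double-counting : ∀ {c N} (tag : B → A) → (∀ {x} → P x → AtLeast c (λ y → Q y × tag y ≡ x)) →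
                      Bounded Q N → ∀ xs → Unique xs → All P xs → length xs * c ≤ N
    double-counting tag fibre bound xs uniq pxs =
      let zs , uzs , c*xs≤zs , qzs = fibres-concat tag fibre xs uniq pxs
      in ≤-trans c*xs≤zs (bound zs uzs (All.map proj₁ qzs))

  module _ {ℓ} {A : Set ℓ} {C : Set} {R : A → A → Set} {Q : A → Set} {P : C → Set} (f : ∀ {x} → Q x → C) where

    length≤-by-encoding : ∀ {N} → (∀ {x} (qx : Q x) → P (f qx)) →
                          (∀ {x y} (qx : Q x) (qy : Q y) → R x y → f qx ≢ f qy) →
                          Bounded P N → ∀ {xs} → AllPairs R xs → All Q xs → length xs ≤ N
    length≤-by-encoding {N} valid separates bound rxs qxs =
      subst (_≤ N) (length-reduce qxs) (bound (All.reduce f qxs) (unique rxs qxs) (valid-all qxs))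
      where
      length-reduce : ∀ {xs} (qxs : All Q xs) → length (All.reduce f qxs) ≡ length xs
      length-reduce []         = refl
      length-reduce (_ ∷ qxs) = cong suc (length-reduce qxs)
      valid-all : ∀ {xs} (qxs : All Q xs) → All P (All.reduce f qxs)
      valid-all []          = []
      valid-all (qx ∷ qxs) = valid qx ∷ valid-all qxs
      apart : ∀ {x xs} (qx : Q x) → All (R x) xs → (qxs : All Q xs) → All (f qx ≢_) (All.reduce f qxs)
      apart qx []          []          = []
      apart qx (rxy ∷ rxs) (qy ∷ qxs) = separates qx qy rxy ∷ apart qx rxs qxs
      unique : ∀ {xs} → AllPairs R xs → (qxs : All Q xs) → Unique (All.reduce f qxs)
      unique []          []          = []
      unique (rx ∷ rxs) (qx ∷ qxs) = apart qx rx qxs ∷ unique rxs qxs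

  module _ {A C : Set} (_≟_ : DecidableEquality A) (key : C → A) where

    Bounded-fibres : ∀ {P : A → Set} {Q : C → Set} {M N} → Bounded P M → (∀ {c} → Q c → P (key c)) →
                     (∀ a → P a → Bounded (λ c → Q c × key c ≡ a) N) → Bounded Q (M * N)
    Bounded-fibres bound keyP fibre [] _ _ = z≤n
    Bounded-fibres {M = zero} bound keyP fibre (c ∷ _) _ (qc ∷ _) =
      contradiction (bound [ key c ] ([] ∷ []) (keyP qc ∷ [])) λ ()
    Bounded-fibres {M = suc M} {N} bound keyP fibre cs@(c ∷ _) uniq qcs@(qc ∷ _) = begin
      length cs                                               ≡⟨ length-filter+length-filter-∁ over? cs ⟨
      length (filter over? cs) + length (filter (∁? over?) cs) ≤⟨ +-mono-≤ inFibre rest ⟩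
      N + M * N                                               ∎
      where
      open ≤-Reasoning
      over? : Decidable (λ c′ → key c′ ≡ key c)
      over? c′ = key c′ ≟ key c
      inFibre : length (filter over? cs) ≤ N
      inFibre = fibre (key c) (keyP qc) _ (Unique.filter⁺ over? uniq) (All-filter over? qcs)
      rest : length (filter (∁? over?) cs) ≤ M * N
      rest = Bounded-fibres (Bounded-without bound (keyP qc)) (λ (qc′ , off) → keyP qc′ , off)
               (λ a (pa , _) → Bounded-mono (λ ((qc′ , _) , on) → qc′ , on) (fibre a pa))
               _ (Unique.filter⁺ (∁? over?) uniq) (All-filter (∁? over?) qcs)

module OrderedTuples (q : ℕ) (1<q : 1 < q) where

  open import Data.Nat
  open import Data.Nat.Properties
  open import Data.Nat.Solver using (module +-*-Solver)
  open import Data.Sum using (inj₁; inj₂)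
  open import Relation.Binary.PropositionalEquality
  open import Relation.Nullary using (yes; no)

  open +-*-Solver

  private instance
    q-nonZero : NonZero q
    q-nonZero = >-nonZero (<-trans z<s 1<q)

  -- indepTuples M r counts the independent r-tuples in F_q^M, and extensions a D r the r-tuples
  -- extending a fixed independent a-tuple to an independent tuple in F_q^D.
  indepTuples : ℕ → ℕ → ℕ
  indepTuples M zero    = 1
  indepTuples M (suc r) = indepTuples M r * (q ^ M ∸ q ^ r)

  extensions : ℕ → ℕ → ℕ → ℕ
  extensions a D zero    = 1
  extensions a D (suc r) = extensions a D r * (q ^ D ∸ q ^ (r + a))

  indepTuples-suc : ∀ M r → indepTuples (suc M) (suc r) ≡ (q ^ suc M ∸ 1) * q ^ r * indepTuples M r
  indepTuples-suc M zero = solve 1 (λ x → con 1 :* x := x :* con 1 :* con 1) refl (q ^ suc M ∸ 1)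
  indepTuples-suc M (suc r) = begin
    indepTuples (suc M) (suc r) * (q ^ suc M ∸ q ^ suc r)
      ≡⟨ cong₂ _*_ (indepTuples-suc M r) (sym (*-distribˡ-∸ q (q ^ M) (q ^ r))) ⟩
    (q ^ suc M ∸ 1) * q ^ r * indepTuples M r * (q * (q ^ M ∸ q ^ r))
      ≡⟨ solve 5 (λ x y z g w → x :* z :* g :* (y :* w) := x :* (y :* z) :* (g :* w)) refl
           (q ^ suc M ∸ 1) q (q ^ r) (indepTuples M r) (q ^ M ∸ q ^ r) ⟩
    (q ^ suc M ∸ 1) * q ^ suc r * indepTuples M (suc r) ∎
    where open ≡-Reasoning

  indepTuples-vanishes : ∀ {M r} → M < r → indepTuples M r ≡ 0
  indepTuples-vanishes {M} {suc r} (s≤s M≤r) with m≤n⇒m<n∨m≡n M≤r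
  ... | inj₁ M<r = cong (_* (q ^ M ∸ q ^ r)) (indepTuples-vanishes M<r)
  ... | inj₂ refl = trans (cong (indepTuples M M *_) (n∸n≡0 (q ^ M))) (*-zeroʳ (indepTuples M M))

  indepTuples-nonZero : ∀ {M r} → r ≤ M → NonZero (indepTuples M r)
  indepTuples-nonZero {M} {zero} _ = _
  indepTuples-nonZero {M} {suc r} r<M =
    m*n≢0 _ _ {{indepTuples-nonZero (<⇒≤ r<M)}} {{>-nonZero (m<n⇒0<n∸m (^-monoʳ-< q 1<q r<M))}}

  indepTuples-*-telescope : ∀ M r → indepTuples M r * ((q ^ suc r ∸ 1) + q * (q ^ M ∸ q ^ r))
                      ≡ indepTuples M r * (q ^ suc M ∸ 1)
  indepTuples-*-telescope M r with r ≤? M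
  ... | yes r≤M = cong (indepTuples M r *_) (begin
    (q ^ suc r ∸ 1) + q * (q ^ M ∸ q ^ r)   ≡⟨ cong ((q ^ suc r ∸ 1) +_) (*-distribˡ-∸ q (q ^ M) (q ^ r)) ⟩
    (q ^ suc r ∸ 1) + (q ^ suc M ∸ q ^ suc r) ≡⟨ telescope (m^n>0 q (suc r)) (^-monoʳ-≤ q (s≤s r≤M)) ⟩
    q ^ suc M ∸ 1                            ∎)
    where
    open ≡-Reasoning
    telescope : ∀ {x y} → 1 ≤ x → x ≤ y → (x ∸ 1) + (y ∸ x) ≡ y ∸ 1
    telescope {suc x} (s≤s _) x≤y = cong (_∸ 1) (m+[n∸m]≡n x≤y)
  ... | no r≰M rewrite indepTuples-vanishes (≰⇒> r≰M) = refl

  indepTuples-qbinom : ∀ M r → indepTuples r r * qbinom q M r ≡ indepTuples M r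
  indepTuples-qbinom zero zero = refl
  indepTuples-qbinom zero (suc r) =
    trans (*-zeroʳ (indepTuples (suc r) (suc r))) (sym (indepTuples-vanishes {0} {suc r} z<s))
  indepTuples-qbinom (suc M) zero = refl
  indepTuples-qbinom (suc M) (suc r) = begin
    Grr′ * (qbinom q M r + q ^ suc r * qbinom q M (suc r))
      ≡⟨ *-distribˡ-+ Grr′ _ _ ⟩
    Grr′ * qbinom q M r + Grr′ * (q ^ suc r * qbinom q M (suc r))
      ≡⟨ cong₂ _+_ lower upper ⟩
    X * q ^ r * G + q ^ suc r * (G * (q ^ M ∸ q ^ r))
      ≡⟨ solve 5 (λ x q p g y → x :* p :* g :+ q :* p :* (g :* y) := p :* (g :* (x :+ q :* y))) refl
           X q (q ^ r) G (q ^ M ∸ q ^ r) ⟩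
    q ^ r * (G * (X + q * (q ^ M ∸ q ^ r)))
      ≡⟨ cong (q ^ r *_) (indepTuples-*-telescope M r) ⟩
    q ^ r * (G * (q ^ suc M ∸ 1))
      ≡⟨ solve 3 (λ p g x → p :* (g :* x) := x :* p :* g) refl (q ^ r) G (q ^ suc M ∸ 1) ⟩
    (q ^ suc M ∸ 1) * q ^ r * G
      ≡⟨ indepTuples-suc M r ⟨
    indepTuples (suc M) (suc r) ∎
    where
    open ≡-Reasoning
    Grr′ = indepTuples (suc r) (suc r)
    G = indepTuples M r
    X = q ^ suc r ∸ 1
    lower : Grr′ * qbinom q M r ≡ X * q ^ r * G
    lower = begin
      Grr′ * qbinom q M r                          ≡⟨ cong (_* qbinom q M r) (indepTuples-suc r r) ⟩
      X * q ^ r * indepTuples r r * qbinom q M r   ≡⟨ *-assoc (X * q ^ r) _ _ ⟩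
      X * q ^ r * (indepTuples r r * qbinom q M r) ≡⟨ cong (X * q ^ r *_) (indepTuples-qbinom M r) ⟩
      X * q ^ r * G                                ∎
    upper : Grr′ * (q ^ suc r * qbinom q M (suc r)) ≡ q ^ suc r * (G * (q ^ M ∸ q ^ r))
    upper = begin
      Grr′ * (q ^ suc r * qbinom q M (suc r)) ≡⟨ solve 3 (λ g p b → g :* (p :* b) := p :* (g :* b)) refl
                                                   Grr′ (q ^ suc r) (qbinom q M (suc r)) ⟩
      q ^ suc r * (Grr′ * qbinom q M (suc r)) ≡⟨ cong (q ^ suc r *_) (indepTuples-qbinom M (suc r)) ⟩
      q ^ suc r * (G * (q ^ M ∸ q ^ r))       ∎

  extensions-shift : ∀ a M r → extensions a (M + a) r ≡ indepTuples M r * (q ^ a) ^ r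
  extensions-shift a M zero = refl
  extensions-shift a M (suc r) = begin
    extensions a (M + a) r * (q ^ (M + a) ∸ q ^ (r + a))
      ≡⟨ cong₂ _*_ (extensions-shift a M r) (cong₂ _∸_ (^-distribˡ-+-* q M a) (^-distribˡ-+-* q r a)) ⟩
    indepTuples M r * (q ^ a) ^ r * (q ^ M * q ^ a ∸ q ^ r * q ^ a)
      ≡⟨ cong (indepTuples M r * (q ^ a) ^ r *_) (*-distribʳ-∸ (q ^ a) (q ^ M) (q ^ r)) ⟨
    indepTuples M r * (q ^ a) ^ r * ((q ^ M ∸ q ^ r) * q ^ a)
      ≡⟨ solve 4 (λ g p y x → g :* p :* (y :* x) := g :* y :* (x :* p)) refl
           (indepTuples M r) ((q ^ a) ^ r) (q ^ M ∸ q ^ r) (q ^ a) ⟩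
    indepTuples M r * (q ^ M ∸ q ^ r) * (q ^ a * (q ^ a) ^ r) ∎
    where open ≡-Reasoning

  ≤-qbinom-by-extensions : ∀ {N a m r} → a ≤ m → N * extensions a (r + a) r ≤ extensions a m r →
                           N ≤ qbinom q (m ∸ a) r
  ≤-qbinom-by-extensions {N} {a} {m} {r} a≤m N*E≤E = *-cancelʳ-≤ N (qbinom q (m ∸ a) r) K {{K-nonZero}} (begin
    N * K                                              ≡⟨ cong (N *_) (extensions-shift a r r) ⟨
    N * extensions a (r + a) r                         ≤⟨ N*E≤E ⟩
    extensions a m r                                   ≡⟨ cong (λ m′ → extensions a m′ r) (m∸n+n≡m a≤m) ⟨
    extensions a (m ∸ a + a) r                         ≡⟨ extensions-shift a (m ∸ a) r ⟩
    indepTuples (m ∸ a) r * (q ^ a) ^ r                ≡⟨ cong (_* (q ^ a) ^ r) (indepTuples-qbinom (m ∸ a) r) ⟨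
    indepTuples r r * qbinom q (m ∸ a) r * (q ^ a) ^ r ≡⟨ solve 3 (λ g b x → g :* b :* x := b :* (g :* x)) refl
                                                            (indepTuples r r) (qbinom q (m ∸ a) r) ((q ^ a) ^ r) ⟩
    qbinom q (m ∸ a) r * K                             ∎)
    where
    open ≤-Reasoning
    K = indepTuples r r * (q ^ a) ^ r
    K-nonZero : NonZero K
    K-nonZero = m*n≢0 (indepTuples r r) ((q ^ a) ^ r)
                  {{indepTuples-nonZero {r} ≤-refl}} {{m^n≢0 (q ^ a) r {{m^n≢0 q a}}}}

module Subspaces {q : ℕ} (F : FiniteField q) (n : ℕ) where

  open import Data.Fin as Fin using (Fin; zero; suc)
  open import Data.List using (List; []; _∷_; [_]; length; map; filter; allFin; cartesianProductWith)
  open import Data.List.Properties as List using (length-map; length-++; filter-≐)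
  open import Data.List.Membership.Propositional using (_∈_)
  open import Data.List.Membership.Propositional.Properties
    using (∈-allFin; ∈-cartesianProductWith⁺; ∈-filter⁺; ∈-filter⁻)
  open import Data.List.Relation.Binary.Disjoint.Propositional using (Disjoint)
  open import Data.List.Relation.Unary.All as All using (All; []; _∷_)
  import Data.List.Relation.Unary.All.Properties as All
  open import Data.List.Relation.Unary.AllPairs using (AllPairs)
  open import Data.List.Relation.Unary.Any as Any using (here)
  open import Data.List.Relation.Unary.Unique.Propositional using (Unique; []; _∷_)
  import Data.List.Relation.Unary.Unique.Propositional.Properties as Unique
  open import Data.Nat as ℕ using (ℕ; zero; suc; _^_; _∸_; _≤_; _<_; z≤n; s≤s)
  import Data.Nat.Properties as ℕ
  open import Data.Product using (Σ; _×_; _,_; proj₁; proj₂)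
  open import Data.Unit using (⊤; tt)
  open import Data.Vec as Vec using (Vec; []; _∷_; lookup; tabulate)
  import Data.Vec.Functional as VF
  import Data.Vec.Properties as Vec
  open import Data.Vec.Relation.Unary.All as VAll using () renaming (All to VAll; [] to []ᵛ; _∷_ to _∷ᵛ_)
  open import Function using (_∘_; id)
  open import Function.Bundles using (Inverse)
  open import Relation.Binary.Definitions using (DecidableEquality)
  open import Relation.Binary.PropositionalEquality as ≡ using (_≡_; _≢_; refl)
  open import Relation.Nullary using (¬_; Dec; yes; no; contradiction)
  open import Relation.Nullary.Decidable using (map′)
  open import Relation.Unary.Properties using (∁?)

  open Counting
  open FiniteField F hiding (zero) renaming (refl to ≈-refl; sym to ≈-sym; trans to ≈-trans)
  open LinAlg F n
  open import Relation.Binary.Reasoning.Setoid setoid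
  open import Algebra.Properties.Ring ring using (-1*x≈-x; x∙y⁻¹≈ε⇒x≈y; +-inverseˡ-unique)
  open import Algebra.Properties.CommutativeSemigroup +-commutativeSemigroup using (interchange)

  private
    toFin : Carrier → Fin q
    toFin = Inverse.from card

    fromFin : Fin q → Carrier
    fromFin = Inverse.to card

    toFin-injective : ∀ {x y} → toFin x ≡ toFin y → x ≈ y
    toFin-injective {x} {y} eq = begin
      x                ≈⟨ Inverse.strictlyInverseˡ card x ⟨
      fromFin (toFin x) ≡⟨ ≡.cong fromFin eq ⟩
      fromFin (toFin y) ≈⟨ Inverse.strictlyInverseˡ card y ⟩
      y                ∎

  1<q : 1 < q
  1<q = distinct⇒1<n (0≉1 ∘ toFin-injective)
    where
    distinct⇒1<n : ∀ {m} {i j : Fin m} → i ≢ j → 1 < m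
    distinct⇒1<n {suc zero} {zero} {zero} i≢j = contradiction refl i≢j
    distinct⇒1<n {suc (suc m)} _ = s≤s (s≤s z≤n)

  _≈?_ : ∀ x y → Dec (x ≈ y)
  x ≈? y = map′ toFin-injective (Inverse.from-cong card) (toFin x Fin.≟ toFin y)

  Word : ℕ → Set
  Word = Vec (Fin q)

  encode : ∀ {d} → (Fin d → Carrier) → Word d
  encode v = tabulate (toFin ∘ v)

  decode : ∀ {d} → Word d → Fin d → Carrier
  decode w j = fromFin (lookup w j)

  decode-encode : ∀ {d} (v : Fin d → Carrier) j → decode (encode v) j ≈ v j
  decode-encode v j =
    ≈-trans (reflexive (≡.cong fromFin (Vec.lookup∘tabulate _ j))) (Inverse.strictlyInverseˡ card (v j))

  encode-decode : ∀ {d} (w : Word d) → encode (decode w) ≡ w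
  encode-decode w = ≡.trans (Vec.tabulate-cong (Inverse.strictlyInverseʳ card ∘ lookup w)) (Vec.tabulate∘lookup w)

  encode-cong : ∀ {d} {u v : Fin d → Carrier} → (∀ j → u j ≈ v j) → encode u ≡ encode v
  encode-cong u≈v = Vec.tabulate-cong (Inverse.from-cong card ∘ u≈v)

  encode-injective : ∀ {d} {u v : Fin d → Carrier} → encode u ≡ encode v → ∀ j → u j ≈ v j
  encode-injective {u = u} {v} eq j = begin
    u j              ≈⟨ decode-encode u j ⟨
    decode (encode u) j ≡⟨ ≡.cong (λ w → decode w j) eq ⟩
    decode (encode v) j ≈⟨ decode-encode v j ⟩
    v j              ∎

  decode-injective : ∀ {d} {w w′ : Word d} → (∀ j → decode w j ≈ decode w′ j) → w ≡ w′
  decode-injective {w = w} {w′} eq = ≡.trans (≡.sym (encode-decode w)) (≡.trans (encode-cong eq) (encode-decode w′))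

  _≟ʷ_ : ∀ {d} → DecidableEquality (Word d)
  _≟ʷ_ = Vec.≡-dec Fin._≟_

  _≈ᵥ?_ : ∀ u v → Dec (u ≈ᵥ v)
  u ≈ᵥ? v = map′ encode-injective encode-cong (encode u ≟ʷ encode v)

  words : ∀ d → List (Word d)
  words zero    = [ [] ]
  words (suc d) = cartesianProductWith Vec._∷_ (allFin q) (words d)

  length-words : ∀ d → length (words d) ≡ q ^ d
  length-words zero    = refl
  length-words (suc d) =
    ≡.trans (length-product (allFin q)) (≡.cong₂ ℕ._*_ (List.length-tabulate {n = q} id) (length-words d))
    where
    length-product : ∀ (xs : List (Fin q)) →
                     length (cartesianProductWith Vec._∷_ xs (words d)) ≡ length xs ℕ.* length (words d)
    length-product []       = refl
    length-product (x ∷ xs) = ≡.trans (length-++ (map (x Vec.∷_) (words d)))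
                                      (≡.cong₂ ℕ._+_ (length-map (x Vec.∷_) (words d)) (length-product xs))

  ∈-words : ∀ {d} (w : Word d) → w ∈ words d
  ∈-words []      = here refl
  ∈-words (x ∷ w) = ∈-cartesianProductWith⁺ Vec._∷_ (∈-allFin x) (∈-words w)

  words-unique : ∀ d → Unique (words d)
  words-unique zero    = [] ∷ []
  words-unique (suc d) = Unique.cartesianProductWith⁺ Vec._∷_ Vec.∷-injective (Unique.allFin⁺ q) (words-unique d)

  ≈ᵥ-sym : ∀ {u v} → u ≈ᵥ v → v ≈ᵥ u
  ≈ᵥ-sym u≈v j = ≈-sym (u≈v j)

  ≈ᵥ-trans : ∀ {u v w} → u ≈ᵥ v → v ≈ᵥ w → u ≈ᵥ w
  ≈ᵥ-trans u≈v v≈w j = ≈-trans (u≈v j) (v≈w j)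

  comb-cong : ∀ {d} {c c′ : Fin d → Carrier} (b : Fin d → V) → (∀ i → c i ≈ c′ i) → comb c b ≈ᵥ comb c′ b
  comb-cong {zero}  b c≈c′ j = ≈-refl
  comb-cong {suc d} b c≈c′ j = +-cong (*-cong (c≈c′ zero) ≈-refl) (comb-cong (b ∘ suc) (c≈c′ ∘ suc) j)

  comb-zero : ∀ {d} (b : Fin d → V) → comb (λ _ → 0#) b ≈ᵥ 0ᵥ
  comb-zero {zero}  b j = ≈-refl
  comb-zero {suc d} b j = ≈-trans (+-cong (zeroˡ _) (comb-zero (b ∘ suc) j)) (+-identityˡ 0#)

  comb-+ : ∀ {d} (c c′ : Fin d → Carrier) (b : Fin d → V) → comb (λ i → c i + c′ i) b ≈ᵥ (comb c b +ᵥ comb c′ b)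
  comb-+ {zero}  c c′ b j = ≈-sym (+-identityˡ 0#)
  comb-+ {suc d} c c′ b j =
    ≈-trans (+-cong (distribʳ (b zero j) (c zero) (c′ zero)) (comb-+ (c ∘ suc) (c′ ∘ suc) (b ∘ suc) j))
            (interchange _ _ _ _)

  comb-· : ∀ {d} a (c : Fin d → Carrier) (b : Fin d → V) → comb (λ i → a * c i) b ≈ᵥ (a · comb c b)
  comb-· {zero}  a c b j = ≈-sym (zeroʳ a)
  comb-· {suc d} a c b j =
    ≈-trans (+-cong (*-assoc a (c zero) (b zero j)) (comb-· a (c ∘ suc) (b ∘ suc) j)) (≈-sym (distribˡ a _ _))

  comb-∈ : (W : Subspace) → ∀ {d} {b : Fin d → V} → (∀ i → mem W (b i)) → ∀ c → mem W (comb c b)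
  comb-∈ W {zero}  b∈W c = 0∈ W
  comb-∈ W {suc d} b∈W c = +∈ W (·∈ W (c zero) (b∈W zero)) (comb-∈ W (b∈W ∘ suc) (c ∘ suc))

  unit : ∀ {d} → Fin d → Fin d → Carrier
  unit zero    zero    = 1#
  unit zero    (suc _) = 0#
  unit (suc i) zero    = 0#
  unit (suc i) (suc j) = unit i j

  comb-unit : ∀ {d} (b : Fin d → V) i → comb (unit i) b ≈ᵥ b i
  comb-unit b zero    j = ≈-trans (+-cong (*-identityˡ _) (comb-zero (b ∘ suc) j)) (+-identityʳ _)
  comb-unit b (suc i) j = ≈-trans (+-cong (zeroˡ _) (comb-unit (b ∘ suc) i j)) (+-identityˡ _)

  InSpan : ∀ {d} → (Fin d → V) → V → Set
  InSpan b v = Σ (Fin _ → Carrier) λ c → v ≈ᵥ comb c b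

  span : ∀ {d} → (Fin d → V) → Subspace
  span b = record
    { mem  = InSpan b
    ; resp = λ { u≈v (c , u≈cb) → c , ≈ᵥ-trans (≈ᵥ-sym u≈v) u≈cb }
    ; 0∈   = (λ _ → 0#) , ≈ᵥ-sym (comb-zero b)
    ; +∈   = λ { (c , u≈cb) (c′ , v≈c′b) →
                 (λ i → c i + c′ i) , ≈ᵥ-trans (λ j → +-cong (u≈cb j) (v≈c′b j)) (≈ᵥ-sym (comb-+ c c′ b)) }
    ; ·∈   = λ { a (c , v≈cb) → (λ i → a * c i) , ≈ᵥ-trans (λ j → *-cong ≈-refl (v≈cb j)) (≈ᵥ-sym (comb-· a c b)) }
    }

  span-⊆ : ∀ {d d′} {b : Fin d → V} {b′ : Fin d′ → V} → (∀ i → InSpan b′ (b i)) → ∀ {v} → InSpan b v → InSpan b′ v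
  span-⊆ {b′ = b′} b⊆b′ (c , v≈cb) = resp (span b′) (≈ᵥ-sym v≈cb) (comb-∈ (span b′) b⊆b′ c)

  span-self : ∀ {d} (b : Fin d → V) i → InSpan b (b i)
  span-self b i = unit i , ≈ᵥ-sym (comb-unit b i)

  InSpan? : ∀ {d} (b : Fin d → V) v → Dec (InSpan b v)
  InSpan? {d} b v with Any.any? (λ w → v ≈ᵥ? comb (decode w) b) (words d)
  ... | yes found = let w , v≈wb = Any.satisfied found in yes (decode w , v≈wb)
  ... | no none   = no λ (c , v≈cb) → none (Any.map (λ { refl → ≈ᵥ-trans v≈cb (comb-cong b (≈-sym ∘ decode-encode c)) })
                                                     (∈-words (encode c)))

  LinIndep-injective : ∀ {d} {b : Fin d → V} → LinIndep b → ∀ {c c′} → comb c b ≈ᵥ comb c′ b → ∀ i → c i ≈ c′ i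
  LinIndep-injective {b = b} indep {c} {c′} cb≈c′b i =
    x∙y⁻¹≈ε⇒x≈y (c i) (c′ i) (≈-trans (+-cong ≈-refl (≈-sym (-1*x≈-x (c′ i)))) (indep _ difference i))
    where
    difference : comb (λ i → c i + - 1# * c′ i) b ≈ᵥ 0ᵥ
    difference j = begin
      comb (λ i → c i + - 1# * c′ i) b j        ≈⟨ comb-+ c (λ i → - 1# * c′ i) b j ⟩
      comb c b j + comb (λ i → - 1# * c′ i) b j ≈⟨ +-cong (cb≈c′b j) (comb-· (- 1#) c′ b j) ⟩
      comb c′ b j + - 1# * comb c′ b j          ≈⟨ +-cong ≈-refl (-1*x≈-x _) ⟩
      comb c′ b j + - comb c′ b j               ≈⟨ -‿inverseʳ _ ⟩
      0#                                        ∎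

  LinIndep-tail : ∀ {d v} {b : Fin d → V} → LinIndep (v VF.∷ b) → LinIndep b
  LinIndep-tail {v = v} indep c cb≈0 i =
    indep (0# VF.∷ c) (λ j → ≈-trans (+-cong (zeroˡ (v j)) (cb≈0 j)) (+-identityˡ 0#)) (suc i)

  LinIndep-head∉span : ∀ {d v} {b : Fin d → V} → LinIndep (v VF.∷ b) → ¬ InSpan b v
  LinIndep-head∉span {v = v} indep (c , v≈cb) = 0≉1 (begin
    0#        ≈⟨ -‿inverseʳ 1# ⟨
    1# + - 1# ≈⟨ +-cong ≈-refl (indep (- 1# VF.∷ c) relation zero) ⟩
    1# + 0#   ≈⟨ +-identityʳ 1# ⟩
    1#        ∎)
    where
    relation : comb (- 1# VF.∷ c) (v VF.∷ _) ≈ᵥ 0ᵥ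
    relation j = ≈-trans (+-cong (-1*x≈-x (v j)) (≈-sym (v≈cb j))) (-‿inverseˡ (v j))

  LinIndep-∷ : ∀ {d v} {b : Fin d → V} → LinIndep b → ¬ InSpan b v → LinIndep (v VF.∷ b)
  LinIndep-∷ {v = v} {b} indep v∉b c relation with c zero ≈? 0#
  ... | yes c₀≈0 = λ { zero → c₀≈0 ; (suc i) → indep (c ∘ suc) tail-relation i }
    where
    tail-relation : comb (c ∘ suc) b ≈ᵥ 0ᵥ
    tail-relation j = begin
      comb (c ∘ suc) b j              ≈⟨ +-identityˡ _ ⟨
      0# + comb (c ∘ suc) b j         ≈⟨ +-cong (≈-sym (≈-trans (*-cong c₀≈0 ≈-refl) (zeroˡ (v j)))) ≈-refl ⟩
      c zero * v j + comb (c ∘ suc) b j ≈⟨ relation j ⟩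
      0#                              ∎
  ... | no c₀≉0 = contradiction (((λ i → (- 1# * y) * c (suc i))) , v≈) v∉b
    where
    y = proj₁ (inverse (c zero) c₀≉0)
    c₀y≈1 = proj₂ (inverse (c zero) c₀≉0)
    v≈ : v ≈ᵥ comb (λ i → (- 1# * y) * c (suc i)) b
    v≈ j = let w = comb (c ∘ suc) b j in begin
      v j                     ≈⟨ *-identityˡ (v j) ⟨
      1# * v j                ≈⟨ *-cong (≈-trans (≈-sym c₀y≈1) (*-comm _ y)) ≈-refl ⟩
      (y * c zero) * v j      ≈⟨ *-assoc y (c zero) (v j) ⟩
      y * (c zero * v j)      ≈⟨ *-cong ≈-refl (+-inverseˡ-unique _ _ (relation j)) ⟩
      y * (- w)               ≈⟨ *-cong ≈-refl (-1*x≈-x w) ⟨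
      y * (- 1# * w)          ≈⟨ *-assoc y (- 1#) w ⟨
      (y * - 1#) * w          ≈⟨ *-cong (*-comm y (- 1#)) ≈-refl ⟩
      (- 1# * y) * w          ≈⟨ comb-· (- 1# * y) (c ∘ suc) b j ⟨
      comb (λ i → (- 1# * y) * c (suc i)) b j ∎

  spanWords : ∀ {d} → (Fin d → V) → List (Word n)
  spanWords {d} b = map (λ w → encode (comb (decode w) b)) (words d)

  length-spanWords : ∀ {d} (b : Fin d → V) → length (spanWords b) ≡ q ^ d
  length-spanWords {d} b = ≡.trans (length-map _ (words d)) (length-words d)

  spanWords-unique : ∀ {d} {b : Fin d → V} → LinIndep b → Unique (spanWords b)
  spanWords-unique {d} indep =
    Unique.map⁺ (λ eq → decode-injective (LinIndep-injective indep (encode-injective eq))) (words-unique d)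

  spanWords-⊆ : ∀ {d} (b : Fin d → V) → All (InSpan b ∘ decode) (spanWords b)
  spanWords-⊆ {d} b = All.map⁺ (All.universal (λ w → decode w , decode-encode (comb (decode w) b)) (words d))

  span-Bounded : ∀ {d} (b : Fin d → V) → Bounded (InSpan b ∘ decode) (q ^ d)
  span-Bounded {d} b = Bounded-image (λ w → encode (comb (decode w) b)) covered
    (≡.subst (Bounded (λ _ → ⊤)) (length-words d) (Bounded-enumeration (words d) (λ {w} _ → ∈-words w)))
    where
    covered : ∀ {x} → InSpan b (decode x) → Σ (Word d) λ w → ⊤ × encode (comb (decode w) b) ≡ x
    covered {x} (c , x≈cb) = encode c , tt ,
      ≡.trans (encode-cong (≈ᵥ-trans (comb-cong b (decode-encode c)) (≈ᵥ-sym x≈cb))) (encode-decode x)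

  LinIndep-q^≤ : ∀ {d D} {e : Fin d → V} {b : Fin D → V} → LinIndep e → (∀ i → InSpan b (e i)) → q ^ d ≤ q ^ D
  LinIndep-q^≤ {D = D} {e} {b} indep e⊆b = ≡.subst (_≤ q ^ D) (length-spanWords e)
    (span-Bounded b (spanWords e) (spanWords-unique indep) (All.map (span-⊆ e⊆b) (spanWords-⊆ e)))

  LinIndep-length≤ : ∀ {d D} {e : Fin d → V} {b : Fin D → V} → LinIndep e → (∀ i → InSpan b (e i)) → d ≤ D
  LinIndep-length≤ indep e⊆b = ℕ.≮⇒≥ λ D<d → ℕ.<⇒≱ (ℕ.^-monoʳ-< q 1<q D<d) (LinIndep-q^≤ indep e⊆b)

  -- If some v ∈ span b were missing from span e, adjoining it would give D + 1 independent vectors in span b.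
  LinIndep-spans : ∀ {D} {e b : Fin D → V} → LinIndep e → (∀ i → InSpan b (e i)) → ∀ {v} → InSpan b v → InSpan e v
  LinIndep-spans {D} {e} indep e⊆b {v} v∈b with InSpan? e v
  ... | yes v∈e = v∈e
  ... | no v∉e  = contradiction (LinIndep-q^≤ {e = v VF.∷ e} (LinIndep-∷ indep v∉e) λ { zero → v∈b ; (suc i) → e⊆b i })
                                 (ℕ.<⇒≱ (ℕ.^-monoʳ-< q 1<q (ℕ.n<1+n D)))

  Outside : ∀ {D d} → (Fin D → V) → (Fin d → V) → Word n → Set
  Outside b B w = InSpan b (decode w) × ¬ InSpan B (decode w)

  Bounded-Outside : ∀ {m d} (b : Fin m → V) {B : Fin d → V} → LinIndep B → (∀ k → InSpan b (B k)) →
                    Bounded (Outside b B) (q ^ m ∸ q ^ d)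
  Bounded-Outside {m} b {B} indep B⊆b xs uniq outside = ℕ.m+n≤o⇒m≤o∸n (length xs)
    (≡.subst (λ l → length xs ℕ.+ l ≤ q ^ m) (length-spanWords B)
      (Bounded-++ (span-Bounded b) uniq (spanWords-unique indep) disjoint
                  (All.map proj₁ outside) (All.map (span-⊆ B⊆b) (spanWords-⊆ B))))
    where
    disjoint : Disjoint xs (spanWords B)
    disjoint (w∈xs , w∈B) = proj₂ (All.lookup outside w∈xs) (All.lookup (spanWords-⊆ B) w∈B)

  AtLeast-Outside : ∀ {D d} {b : Fin D → V} → LinIndep b → (B : Fin d → V) → AtLeast (q ^ D ∸ q ^ d) (Outside b B)
  AtLeast-Outside {D} {d} {b} indep B =
    filter (∁? inB?) (spanWords b) ,
    Unique.filter⁺ (∁? inB?) (spanWords-unique indep) ,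
    outside≥ ,
    All-filter (∁? inB?) (spanWords-⊆ b)
    where
    inB? : ∀ w → Dec (InSpan B (decode w))
    inB? = InSpan? B ∘ decode
    inside = filter inB? (spanWords b)
    outside = filter (∁? inB?) (spanWords b)
    total : length inside ℕ.+ length outside ≡ q ^ D
    total = ≡.trans (length-filter+length-filter-∁ inB? (spanWords b)) (length-spanWords b)
    inside≤ : length inside ≤ q ^ d
    inside≤ = span-Bounded B inside (Unique.filter⁺ inB? (spanWords-unique indep))
                (All.map proj₂ (All-filter inB? (spanWords-⊆ b)))
    outside≥ : q ^ D ∸ q ^ d ≤ length outside
    outside≥ = ℕ.≤-trans (ℕ.∸-monoʳ-≤ (q ^ D) inside≤) (ℕ.≤-reflexive
      (≡.trans (≡.cong (_∸ length inside) (≡.sym total)) (ℕ.m+n∸m≡n (length inside) (length outside))))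

  Code : Set
  Code = List (Word n)

  _≟ᶜ_ : DecidableEquality Code
  _≟ᶜ_ = List.≡-dec _≟ʷ_

  code : ∀ {d} → (Fin d → V) → Code
  code b = filter (InSpan? b ∘ decode) (words n)

  code-≡ : ∀ {d d′} {b : Fin d → V} {b′ : Fin d′ → V} →
           (∀ {v} → InSpan b v → InSpan b′ v) → (∀ {v} → InSpan b′ v → InSpan b v) → code b ≡ code b′
  code-≡ {b = b} {b′} b⊆b′ b′⊆b = filter-≐ (InSpan? b ∘ decode) (InSpan? b′ ∘ decode) (b⊆b′ , b′⊆b) (words n)

  code-⊆ : ∀ {d d′} {b : Fin d → V} {b′ : Fin d′ → V} → code b ≡ code b′ → ∀ {v} → InSpan b v → InSpan b′ v
  code-⊆ {b = b} {b′} eq {v} v∈b = resp (span b′) (decode-encode v)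
    (proj₂ (∈-filter⁻ (InSpan? b′ ∘ decode) {xs = words n} (≡.subst (encode v ∈_) eq
      (∈-filter⁺ (InSpan? b ∘ decode) (∈-words (encode v)) (resp (span b) (≈ᵥ-sym (decode-encode v)) v∈b)))))

  open OrderedTuples q 1<q using (extensions; ≤-qbinom-by-extensions)

  Between : ∀ {a m d} → (Fin a → V) → (Fin m → V) → (Fin d → V) → Set
  Between u w b = LinIndep b × (∀ j → InSpan w (b j)) × (∀ i → InSpan b (u i))

  Intermediate : ∀ {a m} → (Fin a → V) → (Fin m → V) → ℕ → Code → Set
  Intermediate u w d c = Σ (Fin d → V) λ b → Between u w b × c ≡ code b

  Intermediate-resp-code : ∀ {a a′ m d c} {u : Fin a → V} {u′ : Fin a′ → V} {w : Fin m → V} →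
                           code u ≡ code u′ → Intermediate u w d c → Intermediate u′ w d c
  Intermediate-resp-code {u′ = u′} eq (b , (indep , b⊆w , u⊆b) , c≡b) =
    b , (indep , b⊆w , λ i → span-⊆ u⊆b (code-⊆ (≡.sym eq) (span-self u′ i))) , c≡b

  module Extensions {a} (u : Fin a → V) (u-indep : LinIndep u) where

    extend : ∀ {r} → Vec (Word n) r → Fin (r ℕ.+ a) → V
    extend []       = u
    extend (w ∷ ws) = decode w VF.∷ extend ws

    Extension : ∀ {D} → (Fin D → V) → ∀ r → Vec (Word n) r → Set
    Extension b r ws = VAll (InSpan b ∘ decode) ws × LinIndep (extend ws)

    extend-⊆ : ∀ {D r} {b : Fin D → V} {ws : Vec (Word n) r} →
               VAll (InSpan b ∘ decode) ws → (∀ i → InSpan b (u i)) → ∀ k → InSpan b (extend ws k)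
    extend-⊆ []ᵛ            u⊆b k       = u⊆b k
    extend-⊆ (w∈b ∷ᵛ _)     u⊆b zero    = w∈b
    extend-⊆ (_ ∷ᵛ ws⊆b)    u⊆b (suc k) = extend-⊆ ws⊆b u⊆b k

    Extension-tail : ∀ {D r} {b : Fin D → V} {ws : Vec (Word n) (suc r)} →
                     Extension b (suc r) ws → Extension b r (Vec.tail ws)
    Extension-tail (_ ∷ᵛ ws⊆b , indep) = ws⊆b , LinIndep-tail indep

    extension-code : ∀ {r} {b : Fin (r ℕ.+ a) → V} {ws} → Extension b r ws → (∀ i → InSpan b (u i)) →
                     code (extend ws) ≡ code b
    extension-code (ws⊆b , indep) u⊆b =
      code-≡ (span-⊆ (extend-⊆ ws⊆b u⊆b)) (LinIndep-spans indep (extend-⊆ ws⊆b u⊆b))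

    AtLeast-Extension : ∀ {D} {b : Fin D → V} → LinIndep b → (∀ i → InSpan b (u i)) →
                        ∀ r → AtLeast (extensions a D r) (Extension b r)
    AtLeast-Extension indep u⊆b zero = [ [] ] , [] ∷ [] , ℕ.≤-refl , ([]ᵛ , u-indep) ∷ []
    AtLeast-Extension {D} {b} indep u⊆b (suc r) =
      let L , uL , E≤L , extL = AtLeast-Extension indep u⊆b r
          zs , uzs , c*L≤zs , ext = fibres-concat Vec.tail oneMore L uL extL
      in zs , uzs , ℕ.≤-trans (ℕ.*-monoˡ-≤ _ E≤L) c*L≤zs , All.map proj₁ ext
      where
      oneMore : ∀ {ws} → Extension b r ws →
                AtLeast (q ^ D ∸ q ^ (r ℕ.+ a)) (λ ws′ → Extension b (suc r) ws′ × Vec.tail ws′ ≡ ws)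
      oneMore {ws} (ws⊆b , ws-indep) =
        let zs , uzs , c≤zs , out = AtLeast-Outside indep (extend ws)
        in map (_∷ ws) zs ,
           Unique.map⁺ (proj₁ ∘ Vec.∷-injective) uzs ,
           ≡.subst (_ ≤_) (≡.sym (length-map _ zs)) c≤zs ,
           All.map⁺ (All.map (λ (z∈b , z∉ws) → (z∈b ∷ᵛ ws⊆b , LinIndep-∷ ws-indep z∉ws) , refl) out)

    Bounded-Extension : ∀ {m} {w : Fin m → V} → (∀ i → InSpan w (u i)) →
                        ∀ r → Bounded (Extension w r) (extensions a m r)
    Bounded-Extension u⊆w zero = Bounded-enumeration [ [] ] λ { {[]} _ → here refl }
    Bounded-Extension {m} {w} u⊆w (suc r) =
      Bounded-fibres (Vec.≡-dec _≟ʷ_) Vec.tail (Bounded-Extension u⊆w r) Extension-tail oneMore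
      where
      oneMore : ∀ ws → Extension w r ws →
                Bounded (λ ws′ → Extension w (suc r) ws′ × Vec.tail ws′ ≡ ws) (q ^ m ∸ q ^ (r ℕ.+ a))
      oneMore ws (ws⊆w , ws-indep) =
        Bounded-image (_∷ ws) prepended (Bounded-Outside w ws-indep (extend-⊆ ws⊆w u⊆w))
        where
        prepended : ∀ {ws′} → Extension w (suc r) ws′ × Vec.tail ws′ ≡ ws →
                    Σ (Word n) λ z → Outside w (extend ws) z × z ∷ ws ≡ ws′
        prepended {z ∷ _} ((z∈w ∷ᵛ _ , indep) , refl) = z , (z∈w , LinIndep-head∉span indep) , refl

    Bounded-Intermediate′ : ∀ {m} {w : Fin m → V} → (∀ i → InSpan w (u i)) → ∀ r →
                            Bounded (Intermediate u w (r ℕ.+ a)) (qbinom q (m ∸ a) r)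
    Bounded-Intermediate′ {m} {w} u⊆w r xs uniq ixs = ≤-qbinom-by-extensions (LinIndep-length≤ u-indep u⊆w)
      (double-counting (code ∘ extend) tuples (Bounded-Extension u⊆w r) xs uniq ixs)
      where
      tuples : ∀ {c} → Intermediate u w (r ℕ.+ a) c →
               AtLeast (extensions a (r ℕ.+ a) r) (λ ws → Extension w r ws × code (extend ws) ≡ c)
      tuples (b , (b-indep , b⊆w , u⊆b) , refl) =
        let L , uL , E≤L , extL = AtLeast-Extension b-indep u⊆b r
        in L , uL , E≤L ,
           All.map (λ ext → (VAll.map (span-⊆ b⊆w) (proj₁ ext) , proj₂ ext) , extension-code ext u⊆b) extL

  Bounded-Intermediate : ∀ {a m d} {u : Fin a → V} {w : Fin m → V} → LinIndep u → (∀ i → InSpan w (u i)) → a ≤ d →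
                         Bounded (Intermediate u w d) (qbinom q (m ∸ a) (d ∸ a))
  Bounded-Intermediate {a} {m} {d} {u} {w} indep u⊆w a≤d =
    ≡.subst (λ d′ → Bounded (Intermediate u w d′) (qbinom q (m ∸ a) (d ∸ a))) (ℕ.m∸n+n≡m a≤d)
      (Extensions.Bounded-Intermediate′ u indep u⊆w (d ∸ a))

  basis-spans : ∀ {d} W (h : HasDim W d) → ∀ {v} → mem W v → InSpan (proj₁ h) v
  basis-spans _ (_ , _ , _ , spans) {v} v∈W = spans v v∈W

  spans-basis : ∀ {d} W (h : HasDim W d) → ∀ {v} → InSpan (proj₁ h) v → mem W v
  spans-basis W (_ , b∈W , _) (c , v≈cb) = resp W (≈ᵥ-sym v≈cb) (comb-∈ W b∈W c)

  code-≡⇒⊆ : ∀ {d d′} T T′ (h : HasDim T d) (h′ : HasDim T′ d′) → code (proj₁ h) ≡ code (proj₁ h′) → T ⊆ T′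
  code-≡⇒⊆ T T′ h h′ eq v v∈T = spans-basis T′ h′ (code-⊆ eq (basis-spans T h v∈T))

  module PairCounting (k s t i : ℕ) (K₁ K₂ : Subspace)
                      (hK₁ : HasDim K₁ k) (hK₂ : HasDim K₂ k) (hS : HasDim (K₁ ∩ K₂) s) where

    Admissible : Subspace × Subspace → Set
    Admissible (T₁ , T₂) = T₁ ⊆ K₁ × T₂ ⊆ K₂ × HasDim T₁ t × HasDim T₂ t × HasDim (T₁ ∩ T₂) i

    private
      bK₁ = proj₁ hK₁
      bK₂ = proj₁ hK₂
      bS = proj₁ hS

      ∅ : Fin 0 → V
      ∅ ()

      S⊆K₁ : ∀ {v} → InSpan bS v → InSpan bK₁ v
      S⊆K₁ = span-⊆ λ j → basis-spans K₁ hK₁ (proj₁ (proj₁ (proj₂ hS) j))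

      S⊆K₂ : ∀ {v} → InSpan bS v → InSpan bK₂ v
      S⊆K₂ = span-⊆ λ j → basis-spans K₂ hK₂ (proj₂ (proj₁ (proj₂ hS) j))

    PairCode : Code × Code × Code → Set
    PairCode (cI , c₁ , c₂) = Σ (Fin i → V) λ bI →
      Between ∅ bS bI × cI ≡ code bI × Intermediate bI bK₁ t c₁ × Intermediate bI bK₂ t c₂

    pairCode : ∀ {p} → Admissible p → Code × Code × Code
    pairCode (_ , _ , h₁ , h₂ , hI) = code (proj₁ hI) , code (proj₁ h₁) , code (proj₁ h₂)

    pairCode-valid : ∀ {p} (adm : Admissible p) → PairCode (pairCode {p} adm)
    pairCode-valid {T₁ , T₂} (T₁⊆K₁ , T₂⊆K₂ , h₁ , h₂ , hI@(bI , bI∈T , bI-indep , _)) =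
      bI , (bI-indep , bI⊆S , λ ()) , refl ,
      (proj₁ h₁ , (proj₁ (proj₂ (proj₂ h₁)) , (λ j → basis-spans K₁ hK₁ (T₁⊆K₁ _ (proj₁ (proj₂ h₁) j))) ,
                   (λ j → basis-spans T₁ h₁ (proj₁ (bI∈T j)))) , refl) ,
      (proj₁ h₂ , (proj₁ (proj₂ (proj₂ h₂)) , (λ j → basis-spans K₂ hK₂ (T₂⊆K₂ _ (proj₁ (proj₂ h₂) j))) ,
                   (λ j → basis-spans T₂ h₂ (proj₂ (bI∈T j)))) , refl)
      where
      bI⊆S : ∀ j → InSpan bS (bI j)
      bI⊆S j = basis-spans (K₁ ∩ K₂) hS (T₁⊆K₁ _ (proj₁ (bI∈T j)) , T₂⊆K₂ _ (proj₂ (bI∈T j)))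

    pairCode-separates : ∀ {p p′} (adm : Admissible p) (adm′ : Admissible p′) → DistinctPairs p p′ →
                         pairCode {p} adm ≢ pairCode {p′} adm′
    pairCode-separates {T₁ , T₂} {T₁′ , T₂′} (_ , _ , h₁ , h₂ , _) (_ , _ , h₁′ , h₂′ , _) distinct eq =
      distinct ((code-≡⇒⊆ T₁ T₁′ h₁ h₁′ eq₁ , code-≡⇒⊆ T₁′ T₁ h₁′ h₁ (≡.sym eq₁)) ,
                (code-≡⇒⊆ T₂ T₂′ h₂ h₂′ eq₂ , code-≡⇒⊆ T₂′ T₂ h₂′ h₂ (≡.sym eq₂)))
      where
      eq₁ = ≡.cong (proj₁ ∘ proj₂) eq
      eq₂ = ≡.cong (proj₂ ∘ proj₂) eq

    intersection-dim≤ : ∀ {p} → Admissible p → i ≤ t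
    intersection-dim≤ {T₁ , _} (_ , _ , h₁ , _ , (_ , bI∈T , bI-indep , _)) =
      LinIndep-length≤ bI-indep (λ j → basis-spans T₁ h₁ (proj₁ (bI∈T j)))

    Bounded-PairCode : i ≤ t →
                       Bounded PairCode (qbinom q s i ℕ.* (qbinom q (k ∸ i) (t ∸ i) ℕ.* qbinom q (k ∸ i) (t ∸ i)))
    Bounded-PairCode i≤t =
      Bounded-fibres _≟ᶜ_ proj₁ (Bounded-Intermediate {u = ∅} (λ _ _ ()) (λ ()) z≤n)
        (λ (bI , between , cI≡ , _) → bI , between , cI≡) overIntersection
      where
      overIntersection : ∀ cI → Intermediate ∅ bS i cI →
        Bounded (λ c → PairCode c × proj₁ c ≡ cI) (qbinom q (k ∸ i) (t ∸ i) ℕ.* qbinom q (k ∸ i) (t ∸ i))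
      overIntersection cI (bI₀ , (bI₀-indep , bI₀⊆S , _) , cI≡) =
        Bounded-fibres _≟ᶜ_ (proj₁ ∘ proj₂) (Bounded-Intermediate bI₀-indep (S⊆K₁ ∘ bI₀⊆S) i≤t) first overFirst
        where
        first : ∀ {c} → PairCode c × proj₁ c ≡ cI → Intermediate bI₀ bK₁ t (proj₁ (proj₂ c))
        first ((_ , _ , cI′≡ , int₁ , _) , refl) = Intermediate-resp-code (≡.trans (≡.sym cI′≡) cI≡) int₁
        overFirst : ∀ c₁ → Intermediate bI₀ bK₁ t c₁ →
          Bounded (λ c → (PairCode c × proj₁ c ≡ cI) × proj₁ (proj₂ c) ≡ c₁) (qbinom q (k ∸ i) (t ∸ i))
        overFirst c₁ _ =
          Bounded-image (λ c₂ → cI , c₁ , c₂) second (Bounded-Intermediate bI₀-indep (S⊆K₂ ∘ bI₀⊆S) i≤t)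
          where
          second : ∀ {c} → (PairCode c × proj₁ c ≡ cI) × proj₁ (proj₂ c) ≡ c₁ →
                   Σ Code λ c₂ → Intermediate bI₀ bK₂ t c₂ × (cI , c₁ , c₂) ≡ c
          second {_ , _ , c₂} (((_ , _ , cI′≡ , _ , int₂) , refl) , refl) =
            c₂ , Intermediate-resp-code (≡.trans (≡.sym cI′≡) cI≡) int₂ , refl

    length≤ : i ≤ t → ∀ {ps} → AllPairs DistinctPairs ps → All Admissible ps →
              length ps ≤ qbinom q s i ℕ.* (qbinom q (k ∸ i) (t ∸ i) ℕ.* qbinom q (k ∸ i) (t ∸ i))
    length≤ i≤t = length≤-by-encoding (λ {p} → pairCode {p}) (λ {p} → pairCode-valid {p})
                                      (λ {p} {p′} → pairCode-separates {p} {p′}) (Bounded-PairCode i≤t)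

open import Data.Nat using (ℕ; _≤_; _∸_; _*_; _^_; z≤n)
open import Data.Nat.Properties using (*-identityʳ; module ≤-Reasoning)
open import Data.Nat.Primality using (Prime)
open import Data.Integer using (+_; _-_)
open import Data.Integer.Properties using (m-n≡m⊖n; ⊖-≥)
open import Data.Product using (Σ; _×_; _,_)
open import Data.List using (List; []; _∷_; length)
open import Data.List.Relation.Unary.All using (All; _∷_)
open import Data.List.Relation.Unary.AllPairs using (AllPairs)
open import Relation.Binary.PropositionalEquality using (_≡_; cong; trans)

qbinomℤ-∸ : ∀ q m {t i} → i ≤ t → qbinomℤ q m (+ t - + i) ≡ qbinom q m (t ∸ i)
qbinomℤ-∸ q m {t} {i} i≤t = cong (qbinomℤ q m) (trans (m-n≡m⊖n t i) (⊖-≥ i≤t))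

lemma3p2 : (q : ℕ) → (Σ ℕ λ p → Σ ℕ λ m → Prime p × 1 ≤ m × q ≡ p ^ m) →
    (F : FiniteField q) → (n k s t i : ℕ) →
    (K₁ K₂ : LinAlg.Subspace F n) →
    LinAlg.HasDim F n K₁ k → LinAlg.HasDim F n K₂ k →
    LinAlg.HasDim F n (LinAlg._∩_ F n K₁ K₂) s →
    t ≤ k → i ≤ s →
    (ps : List (LinAlg.Subspace F n × LinAlg.Subspace F n)) →
    AllPairs (LinAlg.DistinctPairs F n) ps →
    All (λ { (T₁ , T₂) →
          LinAlg._⊆_ F n T₁ K₁ × LinAlg._⊆_ F n T₂ K₂ ×
          LinAlg.HasDim F n T₁ t × LinAlg.HasDim F n T₂ t ×
          LinAlg.HasDim F n (LinAlg._∩_ F n T₁ T₂) i }) ps →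
    length ps ≤ qbinom q s i * (qbinomℤ q (k ∸ i) (+ t - + i) ^ 2)
lemma3p2 q _ F n k s t i K₁ K₂ hK₁ hK₂ hS _ _ [] _ _ = z≤n
lemma3p2 q _ F n k s t i K₁ K₂ hK₁ hK₂ hS _ _ ps@(p ∷ _) distinct admissible@(adm ∷ _) = begin
  length ps
    ≤⟨ length≤ i≤t distinct admissible ⟩
  qbinom q s i * (K * K)
    ≡⟨ cong (λ x → qbinom q s i * (K * x)) (*-identityʳ K) ⟨
  qbinom q s i * K ^ 2
    ≡⟨ cong (λ x → qbinom q s i * x ^ 2) (qbinomℤ-∸ q (k ∸ i) i≤t) ⟨
  qbinom q s i * (qbinomℤ q (k ∸ i) (+ t - + i) ^ 2) ∎
  where
  open ≤-Reasoning
  open Subspaces.PairCounting F n k s t i K₁ K₂ hK₁ hK₂ hS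
  i≤t = intersection-dim≤ {p} adm
  K = qbinom q (k ∸ i) (t ∸ i)
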